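{- Let $n,m\ge 2$ and let $\mu$ be a positive integer with $\mu\le\min\{m,n\}$. Then the complete bipartite graph $K_{n,m}$ admits a $\mu$-simultaneous edge coloring. Moreover, $\chi'_{\mu\text{ - }SE}(K_{n,m})=\max\{m,n\}$.
   Context: All graphs are finite and simple; $[l]=\{1,\ldots,l\}$. A $\mu$-simultaneous edge coloring of a graph $G$ is a $\mu$-tuple $(c_1,\ldots,c_\mu)$ of proper edge colorings $c_i:E(G)\to[l]$ (with a common color set $[l]$) such that (1) for every vertex $v$, the set $\{c_i(e): e \text{ incident to } v\}$ is the same for all $i=1,\ldots,\mu$, and (2) $c_i(e)\neq c_j(e)$ for every edge $e$ and all $i\neq j$. $G$ is $\mu$-simultaneous edge colorable if it has such a coloring for some $l$, and $\chi'_{\mu\text{ - }SE}(G)$ is the minimum $l$ for which $G$ has a $\mu$-simultaneous edge coloring with color set $[l]$. -}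

module Defs where

open import Data.Nat using (ℕ)
open import Data.Fin using (Fin)
open import Data.Product using (_×_; _,_; proj₁; proj₂; Σ; ∃)
open import Data.Sum using (_⊎_; inj₁; inj₂)
open import Relation.Binary.PropositionalEquality using (_≡_; _≢_)
open import Function.Bundles using (_⇔_)

record Graph : Set₁ where
  field
    V    : Set
    E    : Set
    ends : E → V × V

open Graph public

Incident : (G : Graph) → V G → E G → Set
Incident G v e = proj₁ (ends G e) ≡ v ⊎ proj₂ (ends G e) ≡ v

ProperEdgeColoring : (G : Graph) (l : ℕ) → (E G → Fin l) → Set
ProperEdgeColoring G l c =
  ∀ (v : V G) (e e' : E G) → Incident G v e → Incident G v e' → e ≢ e' → c e ≢ c e'

ColorAt : (G : Graph) (l : ℕ) → (E G → Fin l) → V G → Fin l → Set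
ColorAt G l c v k = Σ (E G) λ e → Incident G v e × c e ≡ k

IsSimultaneousEdgeColoring : (G : Graph) (μ l : ℕ) → (Fin μ → E G → Fin l) → Set
IsSimultaneousEdgeColoring G μ l c =
  (∀ i → ProperEdgeColoring G l (c i))
  × (∀ (v : V G) (i j : Fin μ) (k : Fin l) → ColorAt G l (c i) v k ⇔ ColorAt G l (c j) v k)
  × (∀ (e : E G) (i j : Fin μ) → i ≢ j → c i e ≢ c j e)

SEColorableWith : (G : Graph) (μ l : ℕ) → Set
SEColorableWith G μ l = Σ (Fin μ → E G → Fin l) (IsSimultaneousEdgeColoring G μ l)

SEColorable : (G : Graph) (μ : ℕ) → Set
SEColorable G μ = ∃ λ l → SEColorableWith G μ l

open import Data.Nat using (_≤_)
SEChromaticIndexIs : (G : Graph) (μ χ : ℕ) → Set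
SEChromaticIndexIs G μ χ = SEColorableWith G μ χ × (∀ l → SEColorableWith G μ l → χ ≤ l)

K : ℕ → ℕ → Graph
K n m = record { V = Fin n ⊎ Fin m ; E = Fin n × Fin m ; ends = λ { (i , j) → inj₁ i , inj₂ j } }

-- For m ≤ n, the i-th colouring gives the edge ab of K_{n,m} the colour a + ((b + i) mod m) mod n. At a vertex b of the smaller part every
-- colour occurs; at a vertex a of the larger part the colours are a + {0, …, m − 1} for every i;
-- and two indices i ≠ i' < μ ≤ m shift every edge differently. Conversely, as each colouring is
-- proper, the degrees m and n of the two parts are lower bounds for the number of colours.
module Submission where

open import Defs
open import Data.Nat using (ℕ; suc; _+_; _∸_; _≤_; _⊔_; _⊓_; NonZero)
open import Data.Nat.Properties
  using (+-comm; +-assoc; m∸n+n≡m; m+[n∸m]≡n; m≥n⇒m⊔n≡m; m≤n⇒m⊔n≡n; m⊓n≤m; m⊓n≤n; ⊔-lub; ≤-trans; ≤-total)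
open import Data.Nat.DivMod using (_%_; m%n<n; %-distribˡ-+; m%n%n≡m%n; [m+n]%n≡m%n; m<n⇒m%n≡m)
open import Data.Fin using (Fin; zero; toℕ; fromℕ<; inject≤; _≟_)
open import Data.Fin.Properties using (toℕ-fromℕ<; toℕ-injective; toℕ<n; toℕ≤n; inject≤-injective; injective⇒≤)
open import Data.Product using (_×_; _,_; proj₁; proj₂)
open import Data.Product.Properties using () renaming (swap-involutive to ×-swap-involutive)
import Data.Product as ×
open import Data.Sum using (inj₁; inj₂)
open import Data.Sum.Properties using () renaming (swap-involutive to ⊎-swap-involutive)
import Data.Sum as ⊎
open import Function using (_∘_)
open import Function.Bundles using (_⇔_; mk⇔; Equivalence)
open import Function.Definitions using (Injective)
open import Relation.Binary.PropositionalEquality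
open import Relation.Nullary.Decidable using (decidable-stable)

[m%n+k]%n≡[m+k]%n : ∀ m k n .{{_ : NonZero n}} → (m % n + k) % n ≡ (m + k) % n
[m%n+k]%n≡[m+k]%n m k n = begin
  (m % n + k) % n             ≡⟨ %-distribˡ-+ (m % n) k n ⟩
  (m % n % n + k % n) % n     ≡⟨ cong (λ u → (u + k % n) % n) (m%n%n≡m%n m n) ⟩
  (m % n + k % n) % n         ≡⟨ %-distribˡ-+ m k n ⟨
  (m + k) % n                 ∎
  where open ≡-Reasoning

module CyclicGroup (N : ℕ) .{{_ : NonZero N}} where

  infixl 6 _⊕_ _⊖_

  _⊕_ : Fin N → Fin N → Fin N
  x ⊕ y = fromℕ< (m%n<n (toℕ x + toℕ y) N)

  _⊖_ : Fin N → Fin N → Fin N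
  x ⊖ y = fromℕ< (m%n<n (toℕ x + (N ∸ toℕ y)) N)

  private
    [[x+a]%N+b]%N≡x : ∀ x a b → a + b ≡ N → ((toℕ x + a) % N + b) % N ≡ toℕ x
    [[x+a]%N+b]%N≡x x a b a+b≡N = begin
      ((toℕ x + a) % N + b) % N   ≡⟨ [m%n+k]%n≡[m+k]%n (toℕ x + a) b N ⟩
      (toℕ x + a + b) % N         ≡⟨ cong (_% N) (+-assoc (toℕ x) a b) ⟩
      (toℕ x + (a + b)) % N       ≡⟨ cong (λ u → (toℕ x + u) % N) a+b≡N ⟩
      (toℕ x + N) % N             ≡⟨ [m+n]%n≡m%n (toℕ x) N ⟩
      toℕ x % N                   ≡⟨ m<n⇒m%n≡m (toℕ<n x) ⟩
      toℕ x                       ∎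
      where open ≡-Reasoning

  ⊖-⊕-cancel : ∀ x t → x ⊖ t ⊕ t ≡ x
  ⊖-⊕-cancel x t = toℕ-injective (begin
    toℕ (x ⊖ t ⊕ t)                          ≡⟨ toℕ-fromℕ< _ ⟩
    (toℕ (x ⊖ t) + toℕ t) % N                ≡⟨ cong (λ u → (u + toℕ t) % N) (toℕ-fromℕ< _) ⟩
    ((toℕ x + (N ∸ toℕ t)) % N + toℕ t) % N  ≡⟨ [[x+a]%N+b]%N≡x x (N ∸ toℕ t) (toℕ t) (m∸n+n≡m (toℕ≤n t)) ⟩
    toℕ x                                    ∎)
    where open ≡-Reasoning

  ⊕-⊖-cancel : ∀ x t → x ⊕ t ⊖ t ≡ x
  ⊕-⊖-cancel x t = toℕ-injective (begin
    toℕ (x ⊕ t ⊖ t)                          ≡⟨ toℕ-fromℕ< _ ⟩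
    (toℕ (x ⊕ t) + (N ∸ toℕ t)) % N          ≡⟨ cong (λ u → (u + (N ∸ toℕ t)) % N) (toℕ-fromℕ< _) ⟩
    ((toℕ x + toℕ t) % N + (N ∸ toℕ t)) % N  ≡⟨ [[x+a]%N+b]%N≡x x (toℕ t) (N ∸ toℕ t) (m+[n∸m]≡n (toℕ≤n t)) ⟩
    toℕ x                                    ∎)
    where open ≡-Reasoning

  ⊕-comm : ∀ x y → x ⊕ y ≡ y ⊕ x
  ⊕-comm x y = toℕ-injective (begin
    toℕ (x ⊕ y)            ≡⟨ toℕ-fromℕ< _ ⟩
    (toℕ x + toℕ y) % N    ≡⟨ cong (_% N) (+-comm (toℕ x) (toℕ y)) ⟩
    (toℕ y + toℕ x) % N    ≡⟨ toℕ-fromℕ< _ ⟨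
    toℕ (y ⊕ x)            ∎)
    where open ≡-Reasoning

  ⊕-cancelʳ : ∀ t {x y} → x ⊕ t ≡ y ⊕ t → x ≡ y
  ⊕-cancelʳ t {x} {y} eq = begin
    x          ≡⟨ ⊕-⊖-cancel x t ⟨
    x ⊕ t ⊖ t  ≡⟨ cong (_⊖ t) eq ⟩
    y ⊕ t ⊖ t  ≡⟨ ⊕-⊖-cancel y t ⟩
    y          ∎
    where open ≡-Reasoning

  ⊕-cancelˡ : ∀ t {x y} → t ⊕ x ≡ t ⊕ y → x ≡ y
  ⊕-cancelˡ t {x} {y} eq = ⊕-cancelʳ t (trans (⊕-comm x t) (trans eq (⊕-comm t y)))

IsLatinRectangle : ∀ {n m l} → (Fin n × Fin m → Fin l) → Set
IsLatinRectangle c = (∀ a → Injective _≡_ _≡_ (λ b → c (a , b)))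
                   × (∀ b → Injective _≡_ _≡_ (λ a → c (a , b)))

proper⇔latin : ∀ {n m l} (c : Fin n × Fin m → Fin l) → ProperEdgeColoring (K n m) l c ⇔ IsLatinRectangle c
proper⇔latin c = mk⇔ proper⇒latin latin⇒proper
  where
  proper⇒latin : ProperEdgeColoring _ _ c → IsLatinRectangle c
  proper⇒latin proper =
    (λ a {b} {b'} eq → decidable-stable (b ≟ b') λ b≢b' →
      proper (inj₁ a) (a , b) (a , b') (inj₁ refl) (inj₁ refl) (b≢b' ∘ cong proj₂) eq) ,
    (λ b {a} {a'} eq → decidable-stable (a ≟ a') λ a≢a' →
      proper (inj₂ b) (a , b) (a' , b) (inj₂ refl) (inj₂ refl) (a≢a' ∘ cong proj₁) eq)

  latin⇒proper : IsLatinRectangle c → ProperEdgeColoring _ _ c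
  latin⇒proper (rows , columns) .(inj₁ a) (a , b) (.a , b') (inj₁ refl) (inj₁ refl) e≢e' eq =
    e≢e' (cong (a ,_) (rows a eq))
  latin⇒proper (rows , columns) .(inj₂ b) (a , b) (a' , .b) (inj₂ refl) (inj₂ refl) e≢e' eq =
    e≢e' (cong (_, b) (columns b eq))
  latin⇒proper _ _ _ _ (inj₁ refl) (inj₂ ())
  latin⇒proper _ _ _ _ (inj₂ refl) (inj₁ ())

latin-transpose : ∀ {n m l} {c : Fin m × Fin n → Fin l} → IsLatinRectangle c → IsLatinRectangle (c ∘ ×.swap)
latin-transpose (rows , columns) = columns , rows

incident-swap : ∀ {n m} v e → Incident (K n m) v e → Incident (K m n) (⊎.swap v) (×.swap e)
incident-swap _ _ (inj₁ refl) = inj₂ refl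
incident-swap _ _ (inj₂ refl) = inj₁ refl

K-transpose : ∀ {n m μ l} → SEColorableWith (K m n) μ l → SEColorableWith (K n m) μ l
K-transpose {n} {m} {μ} {l} (c , proper , sameColors , distinct) =
  c' , proper' , (λ v i j k → mk⇔ (move v i j k) (move v j i k)) , λ e → distinct (×.swap e)
  where
  c' : Fin μ → Fin n × Fin m → Fin l
  c' i = c i ∘ ×.swap

  proper' : ∀ i → ProperEdgeColoring (K n m) l (c' i)
  proper' i = Equivalence.from (proper⇔latin (c' i))
    (latin-transpose (Equivalence.to (proper⇔latin (c i)) (proper i)))

  move : ∀ v i j k → ColorAt (K n m) l (c' i) v k → ColorAt (K n m) l (c' j) v k
  move v i j k (e , v∼e , refl) with Equivalence.to (sameColors (⊎.swap v) i j (c' i e)) (×.swap e , incident-swap v e v∼e , refl)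
  ... | e' , v∼e' , eq =
    ×.swap e' ,
    subst (λ u → Incident (K n m) u (×.swap e')) (⊎-swap-involutive v) (incident-swap (⊎.swap v) e' v∼e') ,
    trans (cong (c j) (×-swap-involutive e')) eq

module CyclicColoring {n m μ : ℕ} .{{_ : NonZero n}} .{{_ : NonZero m}} (μ≤m : μ ≤ m) (m≤n : m ≤ n) where
  open CyclicGroup n using () renaming (_⊕_ to _⊕ₙ_; _⊖_ to _⊖ₙ_; ⊖-⊕-cancel to ⊖-⊕-cancelₙ;
    ⊕-cancelʳ to ⊕-cancelʳₙ; ⊕-cancelˡ to ⊕-cancelˡₙ)
  open CyclicGroup m using () renaming (_⊕_ to _⊕ₘ_; _⊖_ to _⊖ₘ_; ⊖-⊕-cancel to ⊖-⊕-cancelₘ;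
    ⊕-cancelʳ to ⊕-cancelʳₘ; ⊕-cancelˡ to ⊕-cancelˡₘ)

  index : Fin μ → Fin m
  index i = inject≤ i μ≤m

  shift : Fin μ → Fin m → Fin n
  shift i b = inject≤ (b ⊕ₘ index i) m≤n

  color : Fin μ → Fin n × Fin m → Fin n
  color i (a , b) = a ⊕ₙ shift i b

  color-latin : ∀ i → IsLatinRectangle (color i)
  color-latin i =
    (λ a eq → ⊕-cancelʳₘ (index i) (inject≤-injective m≤n m≤n _ _ (⊕-cancelˡₙ a eq))) ,
    (λ b eq → ⊕-cancelʳₙ (shift i b) eq)

  move : ∀ v i j k → ColorAt (K n m) n (color i) v k → ColorAt (K n m) n (color j) v k
  move _ i j _ ((a , b) , inj₁ refl , refl) =
    (a , b ⊕ₘ index i ⊖ₘ index j) , inj₁ refl ,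
    cong (λ t → a ⊕ₙ inject≤ t m≤n) (⊖-⊕-cancelₘ (b ⊕ₘ index i) (index j))
  move _ i j k ((a , b) , inj₂ refl , _) =
    (k ⊖ₙ shift j b , b) , inj₂ refl , ⊖-⊕-cancelₙ k (shift j b)

  distinct : ∀ e i j → i ≢ j → color i e ≢ color j e
  distinct (a , b) i j i≢j eq = i≢j (inject≤-injective μ≤m μ≤m i j
    (⊕-cancelˡₘ b (inject≤-injective m≤n m≤n _ _ (⊕-cancelˡₙ a eq))))

  seColorable : SEColorableWith (K n m) μ n
  seColorable = color ,
    (λ i → Equivalence.from (proper⇔latin (color i)) (color-latin i)) ,
    (λ v i j k → mk⇔ (move v i j k) (move v j i k)) ,
    distinct

seColorable⇒⊔≤ : ∀ {n m μ l} → SEColorableWith (K (suc n) (suc m)) (suc μ) l → suc n ⊔ suc m ≤ l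
seColorable⇒⊔≤ (c , proper , _) with Equivalence.to (proper⇔latin (c zero)) (proper zero)
... | rows , columns = ⊔-lub (injective⇒≤ (columns zero)) (injective⇒≤ (rows zero))

corollary2p8 : ∀ (n m μ : ℕ) → 2 ≤ n → 2 ≤ m → 1 ≤ μ → μ ≤ n ⊓ m →
    SEColorable (K n m) μ × SEChromaticIndexIs (K n m) μ (n ⊔ m)
corollary2p8 n@(suc _) m@(suc _) μ@(suc _) _ _ _ μ≤n⊓m =
  (n ⊔ m , colorable) , colorable , λ _ → seColorable⇒⊔≤
  where
  colorable : SEColorableWith (K n m) μ (n ⊔ m)
  colorable with ≤-total m n
  ... | inj₁ m≤n rewrite m≥n⇒m⊔n≡m m≤n =
    CyclicColoring.seColorable (≤-trans μ≤n⊓m (m⊓n≤n n m)) m≤n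
  ... | inj₂ n≤m rewrite m≤n⇒m⊔n≡n n≤m =
    K-transpose (CyclicColoring.seColorable (≤-trans μ≤n⊓m (m⊓n≤m n m)) n≤m)
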